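{- Let $a,b,c,d,q$ be indeterminates and define polynomials $F_m(y)$ by $F_0(y)=1$, $F_m(y)=0$ for $m<0$, and for $m>0$ $$F_m(y)=\big(b+d-y(a+c)q^{m-1}\big)F_{m-1}(y)+(q^{m-1}-1)\big(bd-acq^{m-2}y^2\big)F_{m-2}(y).$$ Then for all $m\ge0$, $$F_m(y)=\sum_{i=0}^m(-1)^i\begin{bmatrix}m\\ i\end{bmatrix}_q q^{\binom i2}y^iA_i(a,c)B_{m-i}(b,d),$$ where $B_m(b,d)=\sum_{i=0}^m\begin{bmatrix}m\\ i\end{bmatrix}_q b^id^{m-i}$ and $A_m(a,c)=\sum_{i=0}^m\begin{bmatrix}m\\ i\end{bmatrix}_{1/q}a^ic^{m-i}$.
   Context: The $q$-binomial coefficient is $\begin{bmatrix}m\\ i\end{bmatrix}_q=\frac{[m]_q!}{[i]_q![m-i]_q!}$ with $[k]_q!=\prod_{j=1}^k(1+q+\dots+q^{j-1})$; $\begin{bmatrix}m\\ i\end{bmatrix}_{1/q}$ is the same with $q$ replaced by $q^{ -1}$. -}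

module Defs where

open import Level using (Level)
open import Data.Nat as ℕ using (ℕ; zero; suc)
open import Data.Nat.Combinatorics using (_C_)
open import Algebra.Bundles using (CommutativeRing)

-- The indeterminates a,b,c,d,q,y are arbitrary ring elements, and the
-- inverse of q (needed for the 1/q-binomials and the q^(m-2) term) is an
-- explicit element qi with q * qi ≈ 1.
module _ {r ℓ : Level} (R : CommutativeRing r ℓ) where
  open CommutativeRing R

  pow : Carrier → ℕ → Carrier
  pow x zero    = 1#
  pow x (suc n) = x * pow x n

  sumTo : ℕ → (ℕ → Carrier) → Carrier
  sumTo zero    f = f 0
  sumTo (suc m) f = sumTo m f + f (suc m)

  qbinom : Carrier → ℕ → ℕ → Carrier
  qbinom q m       zero    = 1#
  qbinom q zero    (suc i) = 0#
  qbinom q (suc m) (suc i) = qbinom q m i + pow q (suc i) * qbinom q m (suc i)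

  -- F_m(y); F_{-1} = 0 is used at m = 1 (the q^(m-2) = q^(-1) = qi term).
  F : (a b c d q qi y : Carrier) → ℕ → Carrier
  F a b c d q qi y zero = 1#
  F a b c d q qi y (suc zero) =
    (b + d - y * (a + c) * pow q 0) * 1#
    + (pow q 0 - 1#) * (b * d - a * c * qi * (y * y)) * 0#
  F a b c d q qi y (suc (suc m)) =
    (b + d - y * (a + c) * pow q (suc m)) * F a b c d q qi y (suc m)
    + (pow q (suc m) - 1#) * (b * d - a * c * pow q m * (y * y)) * F a b c d q qi y m

  B : (q b d : Carrier) → ℕ → Carrier
  B q b d m = sumTo m (λ i → qbinom q m i * pow b i * pow d (m ℕ.∸ i))

  A : (qi a c : Carrier) → ℕ → Carrier
  A qi a c m = sumTo m (λ i → qbinom qi m i * pow a i * pow c (m ℕ.∸ i))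

  RHS : (a b c d q qi y : Carrier) → ℕ → Carrier
  RHS a b c d q qi y m =
    sumTo m (λ i → pow (- 1#) i * qbinom q m i * pow q (i C 2) * pow y i
                   * A qi a c i * B q b d (m ℕ.∸ i))

-- Let G m = ∑ᵢ [m,i]_q Uᵢ B_{m-i} with Uᵢ = (-y)ⁱ q^(i C 2) Aᵢ, the right-hand side.  Read a
-- sequence f as the q-exponential generating function ∑ fₙ zⁿ / [n]_q!: the q-binomial
-- convolution ⋆ becomes the product, the shift fₙ₊₁ the q-derivative D, fₙ ↦ qⁿ fₙ the
-- substitution z ↦ qz, and fₙ ↦ (1 - qⁿ) fₙ₋₁ multiplication by w = (1 - q) z.  Then
-- D B = (b + d - bd w) B, and likewise for A in the 1/q-calculus; the twist by (-y)ⁱ q^(i C 2)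
-- turns the latter into D U = (s + p w) U(qz) with s = -y(a + c), p = ac y².  The q-Leibniz rule gives
-- D G = (b + d - bd w) G + (s + p w) G(qz), which is the recurrence defining F, and F 0 = G 0 = 1.
module Submission where

open import Defs

open import Level using (Level)
open import Algebra.Bundles using (CommutativeRing)
open import Data.Nat as ℕ using (ℕ; zero; suc)
import Data.Nat.Properties as ℕ
open import Data.Integer as ℤ using (ℤ; +_; -[1+_]; _⊖_)
import Data.Integer.Properties as ℤ
open import Data.Maybe.Base using (Maybe; just; nothing)
open import Relation.Nullary.Decidable using (yes; no)
open import Data.Nat.Combinatorics using (_C_; nC1≡n; nCk+nC[k+1]≡[n+1]C[k+1])
open import Relation.Binary.PropositionalEquality as ≡ using (_≡_; cong) renaming (refl to ≡-refl)
open import Algebra.Solver.Ring.AlmostCommutativeRing using (_-Raw-AlmostCommutative⟶_; fromCommutativeRing)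
import Algebra.Solver.Ring

-- Algebra.Solver.Ring for an arbitrary commutative ring, with integer coefficients so that
-- cancellations such as x - x = 0 are decided.
module IntegerSolver {ℓ₁ ℓ₂ : Level} (R : CommutativeRing ℓ₁ ℓ₂) where
  open CommutativeRing R
  open import Algebra.Properties.Ring ring using (-0#≈0#; -‿involutive; -‿distribˡ-*)
  open import Algebra.Properties.AbelianGroup +-abelianGroup using (⁻¹-∙-comm; xyx⁻¹≈y)
  open import Algebra.Properties.Semiring.Mult.TCOptimised semiring using (_×_; 1+×; ×-homo-+)
  open import Relation.Binary.Reasoning.Setoid setoid

  ⟦_⟧ℤ : ℤ → Carrier
  ⟦ + n ⟧ℤ    = n × 1#
  ⟦ -[1+ n ] ⟧ℤ = - (suc n × 1#)

  ⊖-homo : ∀ m n → ⟦ m ⊖ n ⟧ℤ ≈ m × 1# - n × 1#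
  ⊖-homo m zero rewrite ℤ.⊖-≥ (ℕ.z≤n {m}) = sym (trans (+-congˡ -0#≈0#) (+-identityʳ _))
  ⊖-homo zero (suc n) = sym (+-identityˡ _)
  ⊖-homo (suc m) (suc n) rewrite ℤ.[1+m]⊖[1+n]≡m⊖n m n = begin
    ⟦ m ⊖ n ⟧ℤ                          ≈⟨ ⊖-homo m n ⟩
    m × 1# - n × 1#                     ≈⟨ +-congʳ (xyx⁻¹≈y 1# (m × 1#)) ⟨
    (1# + m × 1#) - 1# - n × 1#         ≈⟨ +-assoc _ _ _ ⟩
    (1# + m × 1#) + (- 1# - n × 1#)     ≈⟨ +-congˡ (⁻¹-∙-comm 1# (n × 1#)) ⟩
    (1# + m × 1#) - (1# + n × 1#)       ≈⟨ +-cong (1+× m 1#) (-‿cong (1+× n 1#)) ⟨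
    suc m × 1# - suc n × 1#             ∎

  +-homo : ∀ i j → ⟦ i ℤ.+ j ⟧ℤ ≈ ⟦ i ⟧ℤ + ⟦ j ⟧ℤ
  +-homo (+ m)    (+ n)    = ×-homo-+ 1# m n
  +-homo (+ m)    -[1+ n ] = ⊖-homo m (suc n)
  +-homo -[1+ m ] (+ n)    = trans (⊖-homo n (suc m)) (+-comm _ _)
  +-homo -[1+ m ] -[1+ n ] = begin
    - (suc (suc (m ℕ.+ n)) × 1#)         ≡⟨ cong (λ k → - (suc k × 1#)) (ℕ.+-suc m n) ⟨
    - ((suc m ℕ.+ suc n) × 1#)           ≈⟨ -‿cong (×-homo-+ 1# (suc m) (suc n)) ⟩
    - (suc m × 1# + suc n × 1#)          ≈⟨ ⁻¹-∙-comm _ _ ⟨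
    - (suc m × 1#) - (suc n × 1#)        ∎

  -‿homo : ∀ i → ⟦ ℤ.- i ⟧ℤ ≈ - ⟦ i ⟧ℤ
  -‿homo (+ zero)  = sym -0#≈0#
  -‿homo (+ suc n) = refl
  -‿homo -[1+ n ]  = sym (-‿involutive _)

  +*-homo : ∀ m j → ⟦ + m ℤ.* j ⟧ℤ ≈ m × 1# * ⟦ j ⟧ℤ
  +*-homo zero    j = sym (zeroˡ _)
  +*-homo (suc m) j = begin
    ⟦ + suc m ℤ.* j ⟧ℤ             ≡⟨ cong ⟦_⟧ℤ (ℤ.suc-* (+ m) j) ⟩
    ⟦ j ℤ.+ + m ℤ.* j ⟧ℤ           ≈⟨ +-homo j (+ m ℤ.* j) ⟩
    ⟦ j ⟧ℤ + ⟦ + m ℤ.* j ⟧ℤ        ≈⟨ +-cong (sym (*-identityˡ _)) (+*-homo m j) ⟩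
    1# * ⟦ j ⟧ℤ + m × 1# * ⟦ j ⟧ℤ  ≈⟨ distribʳ _ _ _ ⟨
    (1# + m × 1#) * ⟦ j ⟧ℤ         ≈⟨ *-congʳ (1+× m 1#) ⟨
    suc m × 1# * ⟦ j ⟧ℤ            ∎

  *-homo : ∀ i j → ⟦ i ℤ.* j ⟧ℤ ≈ ⟦ i ⟧ℤ * ⟦ j ⟧ℤ
  *-homo (+ m)    j = +*-homo m j
  *-homo -[1+ m ] j = begin
    ⟦ -[1+ m ] ℤ.* j ⟧ℤ            ≡⟨ cong ⟦_⟧ℤ (ℤ.neg-distribˡ-* (+ suc m) j) ⟨
    ⟦ ℤ.- (+ suc m ℤ.* j) ⟧ℤ       ≈⟨ -‿homo (+ suc m ℤ.* j) ⟩
    - ⟦ + suc m ℤ.* j ⟧ℤ           ≈⟨ -‿cong (+*-homo (suc m) j) ⟩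
    - (suc m × 1# * ⟦ j ⟧ℤ)        ≈⟨ -‿distribˡ-* _ _ ⟩
    ⟦ -[1+ m ] ⟧ℤ * ⟦ j ⟧ℤ         ∎

  ℤ⟶R : ℤ.+-*-rawRing -Raw-AlmostCommutative⟶ fromCommutativeRing R
  ℤ⟶R = record
    { ⟦_⟧ = ⟦_⟧ℤ ; +-homo = +-homo ; *-homo = *-homo ; -‿homo = -‿homo
    ; 0-homo = refl ; 1-homo = refl }

  ≟-coeff : ∀ i j → Maybe (⟦ i ⟧ℤ ≈ ⟦ j ⟧ℤ)
  ≟-coeff i j with i ℤ.≟ j
  ... | yes ≡-refl = just refl
  ... | no _       = nothing

  open Algebra.Solver.Ring ℤ.+-*-rawRing (fromCommutativeRing R) ℤ⟶R ≟-coeff public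

  :0 :1 : ∀ {n} → Polynomial n
  :0 = con (ℤ.+ 0)
  :1 = con (ℤ.+ 1)


module _ {ℓ₁ ℓ₂ : Level} (R : CommutativeRing ℓ₁ ℓ₂) where
  open CommutativeRing R
  open IntegerSolver R using (solve; _:=_; _:+_; _:*_; _:-_; :-_; :0; :1)
  open import Relation.Binary.Reasoning.Setoid setoid
  open import Data.Product.Base using (_×_; _,_; proj₁)

  Seq : Set ℓ₁
  Seq = ℕ → Carrier

  infixr 8 _^_
  _^_ : Carrier → ℕ → Carrier
  x ^ n = pow R x n

  sumTo-cong : ∀ m {f g : Seq} → (∀ i → i ℕ.≤ m → f i ≈ g i) → sumTo R m f ≈ sumTo R m g
  sumTo-cong zero    f≈g = f≈g 0 ℕ.z≤n
  sumTo-cong (suc m) f≈g =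
    +-cong (sumTo-cong m (λ i i≤m → f≈g i (ℕ.m≤n⇒m≤1+n i≤m))) (f≈g (suc m) ℕ.≤-refl)

  sumTo-+ : ∀ m (f g : Seq) → sumTo R m (λ i → f i + g i) ≈ sumTo R m f + sumTo R m g
  sumTo-+ zero    f g = refl
  sumTo-+ (suc m) f g = trans (+-congʳ (sumTo-+ m f g))
    (solve 4 (λ a b c d → (a :+ b) :+ (c :+ d) := (a :+ c) :+ (b :+ d)) refl _ _ _ _)

  *-distribˡ-sumTo : ∀ m a (f : Seq) → a * sumTo R m f ≈ sumTo R m (λ i → a * f i)
  *-distribˡ-sumTo zero    a f = refl
  *-distribˡ-sumTo (suc m) a f = trans (distribˡ _ _ _) (+-congʳ (*-distribˡ-sumTo m a f))

  sumTo-suc : ∀ m (f : Seq) → sumTo R (suc m) f ≈ f 0 + sumTo R m (λ i → f (suc i))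
  sumTo-suc zero    f = refl
  sumTo-suc (suc m) f = trans (+-congʳ (sumTo-suc m f)) (+-assoc _ _ _)

  sumTo-linear : ∀ m a (f g : Seq) → sumTo R m (λ i → f i + a * g i) ≈ sumTo R m f + a * sumTo R m g
  sumTo-linear m a f g = trans (sumTo-+ m f _) (+-congˡ (sym (*-distribˡ-sumTo m a g)))

  ^-+ : ∀ x m n → x ^ (m ℕ.+ n) ≈ x ^ m * x ^ n
  ^-+ x zero    n = sym (*-identityˡ _)
  ^-+ x (suc m) n = trans (*-congˡ (^-+ x m n)) (sym (*-assoc _ _ _))

  ^-distribʳ-* : ∀ x y n → (x * y) ^ n ≈ x ^ n * y ^ n
  ^-distribʳ-* x y zero    = sym (*-identityˡ 1#)
  ^-distribʳ-* x y (suc n) = trans (*-congˡ (^-distribʳ-* x y n))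
    (solve 4 (λ x y a b → (x :* y) :* (a :* b) := (x :* a) :* (y :* b)) refl _ _ _ _)

  ^-inverse : ∀ {x x⁻¹} → x * x⁻¹ ≈ 1# → ∀ n → x ^ n * x⁻¹ ^ n ≈ 1#
  ^-inverse {x} {x⁻¹} xx⁻¹≈1 n = trans (sym (^-distribʳ-* x x⁻¹ n)) (unit^ n)
    where
    unit^ : ∀ n → (x * x⁻¹) ^ n ≈ 1#
    unit^ zero    = refl
    unit^ (suc n) = trans (*-cong xx⁻¹≈1 (unit^ n)) (*-identityˡ 1#)

  ^-suc-C2 : ∀ x n → x ^ (suc n C 2) ≈ x ^ n * x ^ (n C 2)
  ^-suc-C2 x n = trans (reflexive (cong (x ^_) suc-C2)) (^-+ x n (n C 2))
    where
    suc-C2 : suc n C 2 ≡ n ℕ.+ n C 2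
    suc-C2 = ≡.trans (≡.sym (nCk+nC[k+1]≡[n+1]C[k+1] n 1)) (cong (ℕ._+ n C 2) (nC1≡n n))

  recurrence-unique : ∀ (α β : Seq) {f g : Seq} → f 0 ≈ g 0 →
    (∀ n → f (suc n) ≈ α n * f n + β n * f (n ℕ.∸ 1)) →
    (∀ n → g (suc n) ≈ α n * g n + β n * g (n ℕ.∸ 1)) →
    ∀ n → f n ≈ g n
  recurrence-unique α β {f} {g} f₀≈g₀ f-rec g-rec n = proj₁ (agree n)
    where
    agree : ∀ n → f n ≈ g n × f (n ℕ.∸ 1) ≈ g (n ℕ.∸ 1)
    agree zero    = f₀≈g₀ , f₀≈g₀
    agree (suc n) with agree n
    ... | fn≈gn , fn-1≈gn-1 =
      trans (f-rec n) (trans (+-cong (*-congˡ fn≈gn) (*-congˡ fn-1≈gn-1)) (sym (g-rec n))) , fn≈gn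

  module QCalculus (q : Carrier) where

    -- At n = 0 the truncated n ∸ 1 is harmless: the factor 1 - q⁰ vanishes.
    shift dilate zmul : Seq → Seq
    shift  f n = f (suc n)
    dilate f n = q ^ n * f n
    zmul   f n = (1# - q ^ n) * f (n ℕ.∸ 1)

    infixl 7 _⋆_
    _⋆_ : Seq → Seq → Seq
    (f ⋆ g) m = sumTo R m (λ i → qbinom R q m i * f i * g (m ℕ.∸ i))

    m<n⇒qbinom≈0 : ∀ {m n} → m ℕ.< n → qbinom R q m n ≈ 0#
    m<n⇒qbinom≈0 {zero}  {suc n} _             = refl
    m<n⇒qbinom≈0 {suc m} {suc n} (ℕ.s≤s m<n) = begin
      qbinom R q m n + q ^ suc n * qbinom R q m (suc n)
        ≈⟨ +-cong (m<n⇒qbinom≈0 m<n) (*-congˡ (m<n⇒qbinom≈0 (ℕ.m≤n⇒m≤1+n m<n))) ⟩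
      0# + q ^ suc n * 0#
        ≈⟨ solve 1 (λ x → :0 :+ x :* :0 := :0) refl _ ⟩
      0#
        ∎

    ⋆-congˡ : ∀ {f f′ : Seq} → (∀ i → f i ≈ f′ i) → ∀ g m → (f ⋆ g) m ≈ (f′ ⋆ g) m
    ⋆-congˡ f≈f′ g m = sumTo-cong m (λ i _ → *-congʳ (*-congˡ (f≈f′ i)))

    ⋆-congʳ : ∀ {g g′ : Seq} → (∀ i → g i ≈ g′ i) → ∀ f m → (f ⋆ g) m ≈ (f ⋆ g′) m
    ⋆-congʳ g≈g′ f m = sumTo-cong m (λ i _ → *-congˡ (g≈g′ (m ℕ.∸ i)))

    ⋆-linearˡ : ∀ {f f₁ f₂ : Seq} a → (∀ i → f i ≈ f₁ i + a * f₂ i) →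
                ∀ g m → (f ⋆ g) m ≈ (f₁ ⋆ g) m + a * (f₂ ⋆ g) m
    ⋆-linearˡ a f≈ g m = trans (sumTo-cong m (λ i _ → trans (*-congʳ (*-congˡ (f≈ i)))
      (solve 5 (λ a b x y z → b :* (x :+ a :* y) :* z := b :* x :* z :+ a :* (b :* y :* z)) refl _ _ _ _ _)))
      (sumTo-linear m a _ _)

    ⋆-linearʳ : ∀ {g g₁ g₂ : Seq} a → (∀ i → g i ≈ g₁ i + a * g₂ i) →
                ∀ f m → (f ⋆ g) m ≈ (f ⋆ g₁) m + a * (f ⋆ g₂) m
    ⋆-linearʳ a g≈ f m = trans (sumTo-cong m (λ i _ → trans (*-congˡ (g≈ (m ℕ.∸ i)))
      (solve 5 (λ a b x y z → b :* z :* (x :+ a :* y) := b :* z :* x :+ a :* (b :* z :* y)) refl _ _ _ _ _)))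
      (sumTo-linear m a _ _)

    ⋆-scaleˡ : ∀ {f f₁ : Seq} a → (∀ i → f i ≈ a * f₁ i) → ∀ g m → (f ⋆ g) m ≈ a * (f₁ ⋆ g) m
    ⋆-scaleˡ a f≈ g m = trans (sumTo-cong m (λ i _ → trans (*-congʳ (*-congˡ (f≈ i)))
      (solve 4 (λ a b x z → b :* (a :* x) :* z := a :* (b :* x :* z)) refl _ _ _ _)))
      (sym (*-distribˡ-sumTo m a _))

    ⋆-scaleʳ : ∀ {g g₁ : Seq} a → (∀ i → g i ≈ a * g₁ i) → ∀ f m → (f ⋆ g) m ≈ a * (f ⋆ g₁) m
    ⋆-scaleʳ a g≈ f m = trans (sumTo-cong m (λ i _ → trans (*-congˡ (g≈ (m ℕ.∸ i)))
      (solve 4 (λ a b x z → b :* z :* (a :* x) := a :* (b :* z :* x)) refl _ _ _ _)))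
      (sym (*-distribˡ-sumTo m a _))

    -- The q-Pascal rule of qbinom makes the q-derivative satisfy the q-Leibniz rule.
    ⋆-shift : ∀ f g m → (f ⋆ g) (suc m) ≈ (shift f ⋆ g) m + (dilate f ⋆ shift g) m
    ⋆-shift f g m = begin
      (f ⋆ g) (suc m)
        ≈⟨ sumTo-suc m _ ⟩
      1# * f 0 * g (suc m)
        + sumTo R m (λ j → (qbinom R q m j + q ^ suc j * qbinom R q m (suc j)) * f (suc j) * g (m ℕ.∸ j))
        ≈⟨ +-congˡ (trans (sumTo-cong m (λ j _ → trans (*-congʳ (distribʳ _ _ _)) (distribʳ _ _ _)))
                          (sumTo-+ m _ _)) ⟩
      1# * f 0 * g (suc m) + ((shift f ⋆ g) m + sumTo R m (λ j → term (suc j)))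
        ≈⟨ solve 3 (λ x y z → x :+ (y :+ z) := y :+ (x :+ z)) refl _ _ _ ⟩
      (shift f ⋆ g) m + (1# * f 0 * g (suc m) + sumTo R m (λ j → term (suc j)))
        ≈⟨ +-congˡ (+-congʳ (*-congʳ (*-congʳ (sym (*-identityˡ 1#))))) ⟩
      (shift f ⋆ g) m + (term 0 + sumTo R m (λ j → term (suc j)))
        ≈⟨ +-congˡ (sym (sumTo-suc m term)) ⟩
      (shift f ⋆ g) m + (sumTo R m term + term (suc m))
        ≈⟨ +-congˡ (trans (+-congˡ top-term≈0) (+-identityʳ _)) ⟩
      (shift f ⋆ g) m + sumTo R m term
        ≈⟨ +-congˡ (sumTo-cong m reindex) ⟩
      (shift f ⋆ g) m + (dilate f ⋆ shift g) m
        ∎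
      where
      term : Seq
      term i = q ^ i * qbinom R q m i * f i * g (suc m ℕ.∸ i)

      top-term≈0 : term (suc m) ≈ 0#
      top-term≈0 = trans (*-congʳ (*-congʳ (trans (*-congˡ (m<n⇒qbinom≈0 {m} ℕ.≤-refl)) (zeroʳ _))))
                         (trans (*-congʳ (zeroˡ _)) (zeroˡ _))

      reindex : ∀ i → i ℕ.≤ m → term i ≈ qbinom R q m i * dilate f i * shift g (m ℕ.∸ i)
      reindex i i≤m = trans (solve 4 (λ Q b x z → Q :* b :* x :* z := b :* (Q :* x) :* z) refl _ _ _ _)
                            (*-congˡ (reflexive (cong g (ℕ.+-∸-assoc 1 i≤m))))

    dilate-⋆ : ∀ f g m → dilate (f ⋆ g) m ≈ (dilate f ⋆ dilate g) m
    dilate-⋆ f g m = trans (*-distribˡ-sumTo m _ _) (sumTo-cong m (λ i i≤m →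
      trans (*-congʳ (trans (reflexive (cong (q ^_) (≡.sym (ℕ.m+[n∸m]≡n i≤m)))) (^-+ q i (m ℕ.∸ i))))
            (solve 5 (λ Q Q′ b x z → (Q :* Q′) :* (b :* x :* z) := b :* (Q :* x) :* (Q′ :* z)) refl _ _ _ _ _)))

    shift-zmul : ∀ f n → shift (zmul f) n ≈ f n + (- q) * dilate f n
    shift-zmul f n = solve 3 (λ q Q x → (:1 :- q :* Q) :* x := x :+ (:- q) :* (Q :* x)) refl q _ _

    zmul-shift : ∀ f n → zmul (shift f) n ≈ f n + (- 1#) * dilate f n
    zmul-shift f zero    = solve 2 (λ x y → (:1 :- :1) :* y := x :+ (:- :1) :* (:1 :* x)) refl _ _
    zmul-shift f (suc n) = solve 2 (λ Q x → (:1 :- Q) :* x := x :+ (:- :1) :* (Q :* x)) refl _ _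

    dilate-zmul : ∀ f n → dilate (zmul f) n ≈ q * zmul (dilate f) n
    dilate-zmul f zero    = solve 2 (λ q x → :1 :* ((:1 :- :1) :* x)
                                            := q :* ((:1 :- :1) :* (:1 :* x))) refl q _
    dilate-zmul f (suc n) = solve 3 (λ q Q x → (q :* Q) :* ((:1 :- q :* Q) :* x)
                                            := q :* ((:1 :- q :* Q) :* (Q :* x))) refl q _ _

    zmul-cong : ∀ {f g : Seq} → (∀ k → f k ≈ g k) → ∀ n → zmul f n ≈ zmul g n
    zmul-cong f≈g n = *-congˡ (f≈g (n ℕ.∸ 1))

    zmul-linear : ∀ a b {f g h : Seq} → (∀ k → f k ≈ a * g k + b * h k) →
                  ∀ n → zmul f n ≈ a * zmul g n + b * zmul h n
    zmul-linear a b f≈ n = trans (zmul-cong f≈ n)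
      (solve 5 (λ a b Q x y → (:1 :- Q) :* (a :* x :+ b :* y)
                              := a :* ((:1 :- Q) :* x) :+ b :* ((:1 :- Q) :* y)) refl a b _ _ _)

    zmul-⋆ˡ : ∀ m f g → zmul (f ⋆ g) m ≈ (zmul f ⋆ g) m
    zmul-⋆ʳ : ∀ m f g → zmul (f ⋆ g) m ≈ (f ⋆ zmul g) m

    zmul-⋆ˡ zero f g = solve 2 (λ x y → (:1 :- :1) :* (:1 :* x :* y)
                                      := :1 :* ((:1 :- :1) :* x) :* y) refl _ _
    zmul-⋆ˡ (suc m) f g = begin
      (1# - q * q ^ m) * (f ⋆ g) m
        ≈⟨ solve 4 (λ q Q x y → (:1 :- q :* Q) :* x
                                := (x :+ (:- q) :* y) :+ q :* (y :+ (:- :1) :* (Q :* x))) refl q _ _ _ ⟩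
      ((f ⋆ g) m + (- q) * (dilate f ⋆ g) m) + q * ((dilate f ⋆ g) m + (- 1#) * dilate (f ⋆ g) m)
        ≈⟨ +-congˡ (*-congˡ (+-congˡ (*-congˡ (dilate-⋆ f g m)))) ⟩
      ((f ⋆ g) m + (- q) * (dilate f ⋆ g) m) + q * ((dilate f ⋆ g) m + (- 1#) * (dilate f ⋆ dilate g) m)
        ≈⟨ +-cong (⋆-linearˡ (- q) (shift-zmul f) g m) (*-congˡ (⋆-linearʳ (- 1#) (zmul-shift g) (dilate f) m)) ⟨
      (shift (zmul f) ⋆ g) m + q * (dilate f ⋆ zmul (shift g)) m
        ≈⟨ +-congˡ (*-congˡ (trans (sym (zmul-⋆ʳ m (dilate f) (shift g))) (zmul-⋆ˡ m (dilate f) (shift g)))) ⟩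
      (shift (zmul f) ⋆ g) m + q * (zmul (dilate f) ⋆ shift g) m
        ≈⟨ +-congˡ (⋆-scaleˡ q (dilate-zmul f) (shift g) m) ⟨
      (shift (zmul f) ⋆ g) m + (dilate (zmul f) ⋆ shift g) m
        ≈⟨ ⋆-shift (zmul f) g m ⟨
      (zmul f ⋆ g) (suc m)
        ∎

    zmul-⋆ʳ zero f g = solve 2 (λ x y → (:1 :- :1) :* (:1 :* x :* y)
                                      := :1 :* x :* ((:1 :- :1) :* y)) refl _ _
    zmul-⋆ʳ (suc m) f g = begin
      (1# - q * q ^ m) * (f ⋆ g) m
        ≈⟨ solve 4 (λ q Q x y → (:1 :- q :* Q) :* x := (x :+ (:- :1) :* y) :+ (y :+ (:- q) :* (Q :* x))) refl q _ _ _ ⟩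
      ((f ⋆ g) m + (- 1#) * (dilate f ⋆ g) m) + ((dilate f ⋆ g) m + (- q) * dilate (f ⋆ g) m)
        ≈⟨ +-congˡ (+-congˡ (*-congˡ (dilate-⋆ f g m))) ⟩
      ((f ⋆ g) m + (- 1#) * (dilate f ⋆ g) m) + ((dilate f ⋆ g) m + (- q) * (dilate f ⋆ dilate g) m)
        ≈⟨ +-cong (⋆-linearˡ (- 1#) (zmul-shift f) g m) (⋆-linearʳ (- q) (shift-zmul g) (dilate f) m) ⟨
      (zmul (shift f) ⋆ g) m + (dilate f ⋆ shift (zmul g)) m
        ≈⟨ +-congʳ (trans (sym (zmul-⋆ˡ m (shift f) g)) (zmul-⋆ʳ m (shift f) g)) ⟩
      (shift f ⋆ zmul g) m + (dilate f ⋆ shift (zmul g)) m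
        ≈⟨ ⋆-shift f (zmul g) m ⟨
      (f ⋆ zmul g) (suc m)
        ∎

    zquad : Carrier → Carrier → Seq → Seq
    zquad a b f n = f n + a * zmul f n + b * zmul (zmul f) n

    zmul-zquad : ∀ a b f n → zmul (zquad a b f) n ≈ zquad a b (zmul f) n
    zmul-zquad a b f n = solve 6 (λ a b Q x y z → (:1 :- Q) :* (x :+ a :* y :+ b :* z)
      := (:1 :- Q) :* x :+ a :* ((:1 :- Q) :* y) :+ b :* ((:1 :- Q) :* z)) refl a b _ _ _ _

    ⋆-zquadˡ : ∀ a b f g m → (zquad a b f ⋆ g) m ≈ zquad a b (f ⋆ g) m
    ⋆-zquadˡ a b f g m = begin
      (zquad a b f ⋆ g) m
        ≈⟨ ⋆-linearˡ {f₁ = λ i → f i + a * zmul f i} {zmul (zmul f)} b (λ _ → refl) g m ⟩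
      ((λ i → f i + a * zmul f i) ⋆ g) m + b * (zmul (zmul f) ⋆ g) m
        ≈⟨ +-congʳ (⋆-linearˡ {f₁ = f} {zmul f} a (λ _ → refl) g m) ⟩
      (f ⋆ g) m + a * (zmul f ⋆ g) m + b * (zmul (zmul f) ⋆ g) m
        ≈⟨ +-cong (+-congˡ (*-congˡ (zmul-⋆ˡ m f g)))
                  (*-congˡ (trans (zmul-cong (λ k → zmul-⋆ˡ k f g) m) (zmul-⋆ˡ m (zmul f) g))) ⟨
      zquad a b (f ⋆ g) m
        ∎

    ⋆-zquadʳ : ∀ a b f g m → (f ⋆ zquad a b g) m ≈ zquad a b (f ⋆ g) m
    ⋆-zquadʳ a b f g m = begin
      (f ⋆ zquad a b g) m
        ≈⟨ ⋆-linearʳ {g₁ = λ i → g i + a * zmul g i} {zmul (zmul g)} b (λ _ → refl) f m ⟩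
      (f ⋆ (λ i → g i + a * zmul g i)) m + b * (f ⋆ zmul (zmul g)) m
        ≈⟨ +-congʳ (⋆-linearʳ {g₁ = g} {zmul g} a (λ _ → refl) f m) ⟩
      (f ⋆ g) m + a * (f ⋆ zmul g) m + b * (f ⋆ zmul (zmul g)) m
        ≈⟨ +-cong (+-congˡ (*-congˡ (zmul-⋆ʳ m f g)))
                  (*-congˡ (trans (zmul-cong (λ k → zmul-⋆ʳ k f g) m) (zmul-⋆ʳ m f (zmul g)))) ⟨
      zquad a b (f ⋆ g) m
        ∎

    dilate-^ : ∀ β n → dilate (β ^_) n ≈ β ^ n + (- β) * zmul (β ^_) n
    dilate-^ β zero    = solve 1 (λ β → :1 :* :1
      := :1 :+ (:- β) :* ((:1 :- :1) :* :1)) refl β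
    dilate-^ β (suc n) = solve 4 (λ q β Q P → (q :* Q) :* (β :* P)
      := β :* P :+ (:- β) :* ((:1 :- q :* Q) :* P)) refl q β _ _

    ^⋆^-recurrence : ∀ β δ k → ((β ^_) ⋆ (δ ^_)) (suc k)
                     ≈ (β + δ) * ((β ^_) ⋆ (δ ^_)) k + (- (β * δ)) * zmul ((β ^_) ⋆ (δ ^_)) k
    ^⋆^-recurrence β δ k = begin
      ((β ^_) ⋆ (δ ^_)) (suc k)
        ≈⟨ ⋆-shift (β ^_) (δ ^_) k ⟩
      (shift (β ^_) ⋆ (δ ^_)) k + (dilate (β ^_) ⋆ shift (δ ^_)) k
        ≈⟨ +-cong (⋆-scaleˡ β (λ _ → refl) (δ ^_) k)
                  (⋆-scaleʳ {g₁ = δ ^_} δ (λ _ → refl) (dilate (β ^_)) k) ⟩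
      β * G k + δ * (dilate (β ^_) ⋆ (δ ^_)) k
        ≈⟨ +-congˡ (*-congˡ (⋆-linearˡ (- β) (dilate-^ β) (δ ^_) k)) ⟩
      β * G k + δ * (G k + (- β) * (zmul (β ^_) ⋆ (δ ^_)) k)
        ≈⟨ +-congˡ (*-congˡ (+-congˡ (*-congˡ (zmul-⋆ˡ k (β ^_) (δ ^_))))) ⟨
      β * G k + δ * (G k + (- β) * zmul G k)
        ≈⟨ solve 4 (λ β δ x y → β :* x :+ δ :* (x :+ (:- β) :* y)
                                := (β :+ δ) :* x :+ (:- (β :* δ)) :* y) refl β δ _ _ ⟩
      (β + δ) * G k + (- (β * δ)) * zmul G k
        ∎
      where
      G : Seq
      G = (β ^_) ⋆ (δ ^_)

    -- With w = (1 - q) z this is the q-Leibniz rule for G = U E when D U = (s + p w) U(qz) and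
    -- D E = (t + r w) E, after writing U = (1 + s w + p w²) U(qz) and E(qz) = (1 - t w - r w²) E.
    ⋆-recurrence : ∀ {U E : Seq} {s p t r} →
      (∀ k → shift U k ≈ s * dilate U k + p * zmul (dilate U) k) →
      (∀ k → shift E k ≈ t * E k + r * zmul E k) →
      ∀ n → (U ⋆ E) (suc n)
            ≈ t * (U ⋆ E) n + r * zmul (U ⋆ E) n + s * dilate (U ⋆ E) n + p * zmul (dilate (U ⋆ E)) n
    ⋆-recurrence {U} {E} {s} {p} {t} {r} U-rec E-rec n = begin
      G (suc n)
        ≈⟨ ⋆-shift U E n ⟩
      (shift U ⋆ E) n + (V ⋆ shift E) n
        ≈⟨ +-cong (⋆-linearˡ p U-rec E n) (⋆-linearʳ r E-rec V n) ⟩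
      (((λ k → s * V k) ⋆ E) n + p * (zmul V ⋆ E) n) + ((V ⋆ (λ k → t * E k)) n + r * (V ⋆ zmul E) n)
        ≈⟨ +-cong (+-cong (⋆-scaleˡ s (λ _ → refl) E n) (*-congˡ (sym (zmul-⋆ˡ n V E))))
                  (+-cong (⋆-scaleʳ {g₁ = E} t (λ _ → refl) V n) (*-congˡ (sym (zmul-⋆ʳ n V E)))) ⟩
      (s * X n + p * zmul X n) + (t * X n + r * zmul X n)
        ≈⟨ solve 8 (λ s p t r x₀ x₁ x₂ x₃ →
             (s :* x₀ :+ p :* x₁) :+ (t :* x₀ :+ r :* x₁)
             := t :* (x₀ :+ s :* x₁ :+ p :* x₂) :+ r :* (x₁ :+ s :* x₂ :+ p :* x₃)
                :+ s :* (x₀ :+ (:- t) :* x₁ :+ (:- r) :* x₂) :+ p :* (x₁ :+ (:- t) :* x₂ :+ (:- r) :* x₃))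
             refl s p t r (X n) (zmul X n) (zmul (zmul X) n) (zmul (zmul (zmul X)) n) ⟩
      t * zquad s p X n + r * zquad s p (zmul X) n + s * zquad (- t) (- r) X n + p * zquad (- t) (- r) (zmul X) n
        ≈⟨ +-cong (+-cong (+-cong (*-congˡ (G≈ n)) (*-congˡ (zmul-G≈ n))) (*-congˡ (dilate-G≈ n)))
                  (*-congˡ (zmul-dilate-G≈ n)) ⟨
      t * G n + r * zmul G n + s * dilate G n + p * zmul (dilate G) n
        ∎
      where
      V X G : Seq
      V = dilate U
      X = V ⋆ E
      G = U ⋆ E

      U≈ : ∀ k → U k ≈ zquad s p V k
      U≈ k = begin
        U k                                   ≈⟨ solve 2 (λ u v → u := v :+ (u :+ (:- :1) :* v)) refl _ _ ⟩
        V k + (U k + (- 1#) * V k)            ≈⟨ +-congˡ (zmul-shift U k) ⟨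
        V k + zmul (shift U) k                ≈⟨ +-congˡ (zmul-linear s p U-rec k) ⟩
        V k + (s * zmul V k + p * zmul (zmul V) k) ≈⟨ +-assoc _ _ _ ⟨
        zquad s p V k                         ∎

      dilate-E≈ : ∀ k → dilate E k ≈ zquad (- t) (- r) E k
      dilate-E≈ k = begin
        dilate E k                            ≈⟨ solve 2 (λ e d → d := e :+ (:- :1) :* (e :+ (:- :1) :* d)) refl _ _ ⟩
        E k + (- 1#) * (E k + (- 1#) * dilate E k) ≈⟨ +-congˡ (*-congˡ (zmul-shift E k)) ⟨
        E k + (- 1#) * zmul (shift E) k       ≈⟨ +-congˡ (*-congˡ (zmul-linear t r E-rec k)) ⟩
        E k + (- 1#) * (t * zmul E k + r * zmul (zmul E) k)
          ≈⟨ solve 5 (λ e t r x y → e :+ (:- :1) :* (t :* x :+ r :* y)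
                                    := e :+ (:- t) :* x :+ (:- r) :* y) refl _ t r _ _ ⟩
        zquad (- t) (- r) E k                 ∎

      G≈ : ∀ n → G n ≈ zquad s p X n
      G≈ n = trans (⋆-congˡ U≈ E n) (⋆-zquadˡ s p V E n)

      dilate-G≈ : ∀ n → dilate G n ≈ zquad (- t) (- r) X n
      dilate-G≈ n = trans (dilate-⋆ U E n) (trans (⋆-congʳ dilate-E≈ V n) (⋆-zquadʳ (- t) (- r) V E n))

      zmul-G≈ : ∀ n → zmul G n ≈ zquad s p (zmul X) n
      zmul-G≈ n = trans (zmul-cong G≈ n) (zmul-zquad s p X n)

      zmul-dilate-G≈ : ∀ n → zmul (dilate G) n ≈ zquad (- t) (- r) (zmul X) n
      zmul-dilate-G≈ n = trans (zmul-cong dilate-G≈ n) (zmul-zquad (- t) (- r) X n)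

  twist : (q c : Carrier) → Seq → Seq
  twist q c A i = c ^ i * q ^ (i C 2) * A i

  -- The only use of q * q⁻¹ ≈ 1: (1 - q⁻ᵏ) qᵏ = -(1 - qᵏ) turns the 1/q-recurrence of A into a q-recurrence.
  twist-recurrence : ∀ {q q⁻¹ α β c} {A : Seq} → q * q⁻¹ ≈ 1# →
    (∀ k → A (suc k) ≈ α * A k + β * QCalculus.zmul q⁻¹ A k) →
    let open QCalculus q in
    ∀ k → shift (twist q c A) k ≈ (c * α) * dilate (twist q c A) k + (- (c * c * β)) * zmul (dilate (twist q c A)) k
  twist-recurrence {q} {q⁻¹} {α} {β} {c} {A} qq⁻¹≈1 A-rec zero = begin
    (c * 1#) * q ^ 0 * A 1
      ≈⟨ *-congˡ (A-rec 0) ⟩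
    (c * 1#) * 1# * (α * A 0 + β * ((1# - 1#) * A 0))
      ≈⟨ solve 4 (λ c α β x → (c :* :1) :* :1 :* (α :* x :+ β :* ((:1 :- :1) :* x))
           := (c :* α) :* (:1 :* (:1 :* :1 :* x))
              :+ (:- (c :* c :* β)) :* ((:1 :- :1) :* (:1 :* (:1 :* :1 :* x)))) refl c α β _ ⟩
    (c * α) * (1# * (1# * 1# * A 0)) + (- (c * c * β)) * ((1# - 1#) * (1# * (1# * 1# * A 0)))
      ∎
  twist-recurrence {q} {q⁻¹} {α} {β} {c} {A} qq⁻¹≈1 A-rec (suc j) = begin
    c * (c * c ^ j) * q ^ (suc (suc j) C 2) * A (suc (suc j))
      ≈⟨ *-cong (*-congˡ (trans (^-suc-C2 q (suc j)) (*-congˡ (^-suc-C2 q j)))) (A-rec (suc j)) ⟩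
    c * (c * c ^ j) * (q * q ^ j * (q ^ j * q ^ (j C 2))) * (α * A (suc j) + β * ((1# - q⁻¹ * q⁻¹ ^ j) * A j))
      ≈⟨ solve 11 (λ c α β q Q K C q⁻¹ Q⁻¹ a₁ a₀ →
           c :* (c :* C) :* (q :* Q :* (Q :* K)) :* (α :* a₁ :+ β :* ((:1 :- q⁻¹ :* Q⁻¹) :* a₀))
           := (c :* α) :* (q :* Q :* (c :* C :* (Q :* K) :* a₁))
              :+ (:- (c :* c :* β)) :* ((q :* Q :* (q⁻¹ :* Q⁻¹) :- q :* Q) :* (Q :* (C :* K :* a₀))))
           refl c α β q _ _ _ q⁻¹ _ _ _ ⟩
    (c * α) * (q * q ^ j * (c * c ^ j * (q ^ j * q ^ (j C 2)) * A (suc j)))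
      + (- (c * c * β)) * ((q ^ suc j * q⁻¹ ^ suc j - q * q ^ j) * (q ^ j * (c ^ j * q ^ (j C 2) * A j)))
      ≈⟨ +-cong (*-congˡ (*-congˡ (*-congʳ (*-congˡ (sym (^-suc-C2 q j))))))
                (*-congˡ (*-congʳ (+-congʳ (^-inverse qq⁻¹≈1 (suc j))))) ⟩
    (c * α) * (q * q ^ j * (c * c ^ j * q ^ (suc j C 2) * A (suc j)))
      + (- (c * c * β)) * ((1# - q * q ^ j) * (q ^ j * (c ^ j * q ^ (j C 2) * A j)))
      ∎

  module Theorem7p7 (a b c d q qi y : Carrier) (q*qi≈1 : q * qi ≈ 1#) where
    open QCalculus q
    private module Qi = QCalculus qi

    U : Seq
    U = twist q (- 1# * y) (A R qi a c)

    s t p r : Carrier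
    s = - 1# * y * (a + c)
    t = b + d
    p = - (- 1# * y * (- 1# * y) * - (a * c))
    r = - (b * d)

    α β : Seq
    α n = t + s * q ^ n
    β n = (1# - q ^ n) * (r + p * q ^ (n ℕ.∸ 1))

    F-recurrence : ∀ n → F R a b c d q qi y (suc n) ≈ α n * F R a b c d q qi y n + β n * F R a b c d q qi y (n ℕ.∸ 1)
    F-recurrence zero = solve 6 (λ a b c d y qi →
      (b :+ d :- y :* (a :+ c) :* :1) :* :1
        :+ (:1 :- :1) :* (b :* d :- a :* c :* qi :* (y :* y)) :* :0
      := (b :+ d :+ (:- :1 :* y :* (a :+ c)) :* :1) :* :1
        :+ (:1 :- :1)
           :* (:- (b :* d) :+ (:- (:- :1 :* y :* (:- :1 :* y) :* (:- (a :* c)))) :* :1)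
           :* :1) refl a b c d y qi
    F-recurrence (suc n) = solve 9 (λ a b c d y q Q f₁ f₀ →
      (b :+ d :- y :* (a :+ c) :* (q :* Q)) :* f₁ :+ (q :* Q :- :1) :* (b :* d :- a :* c :* Q :* (y :* y)) :* f₀
      := (b :+ d :+ (:- :1 :* y :* (a :+ c)) :* (q :* Q)) :* f₁
        :+ (:1 :- q :* Q)
           :* (:- (b :* d) :+ (:- (:- :1 :* y :* (:- :1 :* y) :* (:- (a :* c)))) :* Q) :* f₀)
      refl a b c d y q _ _ _

    U-recurrence : ∀ k → shift U k ≈ s * dilate U k + p * zmul (dilate U) k
    U-recurrence = twist-recurrence q*qi≈1 (Qi.^⋆^-recurrence a c)

    G : Seq
    G = U ⋆ B R q b d

    G-recurrence : ∀ n → G (suc n) ≈ α n * G n + β n * G (n ℕ.∸ 1)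
    G-recurrence n = trans (⋆-recurrence U-recurrence (^⋆^-recurrence b d) n)
      (solve 8 (λ t r s p Q Q′ g₀ g₁ →
         t :* g₀ :+ r :* ((:1 :- Q) :* g₁) :+ s :* (Q :* g₀) :+ p :* ((:1 :- Q) :* (Q′ :* g₁))
         := (t :+ s :* Q) :* g₀ :+ (:1 :- Q) :* (r :+ p :* Q′) :* g₁) refl t r s p _ _ _ _)

    F≈⋆ : ∀ m → F R a b c d q qi y m ≈ G m
    F≈⋆ = recurrence-unique α β F₀≈G₀ F-recurrence G-recurrence
      where
      F₀≈G₀ : 1# ≈ G 0
      F₀≈G₀ = solve 0 (:1 := :1 :* (:1 :* :1 :* (:1 :* :1 :* :1)) :* (:1 :* :1 :* :1)) refl

    RHS≈⋆ : ∀ m → RHS R a b c d q qi y m ≈ G m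
    RHS≈⋆ m = sumTo-cong m (λ i _ →
      trans (solve 6 (λ σ qb κ υ x z → σ :* qb :* κ :* υ :* x :* z := qb :* (σ :* υ :* κ :* x) :* z) refl _ _ _ _ _ _)
            (*-congʳ (*-congˡ (*-congʳ (*-congʳ (sym (^-distribʳ-* (- 1#) y i)))))))

theorem7p7 : {r ℓ : Level} (R : CommutativeRing r ℓ) →
    let open CommutativeRing R in
    (a b c d q qi y : Carrier) → q * qi ≈ 1# → (m : ℕ) →
    F R a b c d q qi y m ≈ RHS R a b c d q qi y m
theorem7p7 R a b c d q qi y q*qi≈1 m = trans (F≈⋆ m) (sym (RHS≈⋆ m))
  where
  open CommutativeRing R using (trans; sym)
  open Theorem7p7 R a b c d q qi y q*qi≈1
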